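{- For every symmetric stable matching instance, the mutual closest pair algorithm (described below) terminates with a matching that is stable. Mutual closest pair algorithm: start with the empty matching, all students unmatched and every school with its full quota remaining. While some student is unmatched: among the currently unmatched students and the schools with positive remaining quota, find any student $s$ and school $x$ such that $x$ is the closest such school to $s$ and $s$ is the closest such student to $x$; assign $s$ to $x$, mark $s$ as matched, decrease the remaining quota of $x$ by one, and remove $x$ from consideration if its remaining quota becomes zero.
   Context: A (one-to-many) stable matching instance consists of a set of $n$ students and a set of $m$ schools, each school having a positive integer quota, with the quotas summing to $n$. Each student gives a score to each school and each school gives a score to each student; each agent's scores for the agents of the opposite set are pairwise distinct, and each agent prefers agents of the opposite set in increasing order of score. The instance is symmetric if for every student $s$ and school $x$ the score of $s$ for $x$ equals the score of $x$ for $s$ (called the distance between them). A matching assigns each student to exactly one school so that each school is assigned exactly its quota of students. It is stable if there is no blocking pair, i.e., no student $s$ and school $x$ with $s$ not assigned to $x$ such that $s$ prefers $x$ to its assigned school and $x$ prefers $s$ to at least one of the students assigned to $x$. -}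

module Defs where

open import Data.Nat using (ℕ; zero; suc; _<_; _≤_)
open import Data.Fin using (Fin; _≟_)
open import Data.List using (List; length; filter; map; allFin)
open import Data.Nat.ListAction using (sum)
open import Data.Maybe using (Maybe; just; nothing)
open import Data.Product using (Σ; ∃; _×_; _,_)
open import Relation.Nullary using (¬_; yes; no)
open import Relation.Binary.PropositionalEquality using (_≡_; _≢_)
open import Relation.Binary.Construct.Closure.ReflexiveTransitive using (Star)
open import Induction.WellFounded using (Acc)
open import Function using (flip)

-- A one-to-many stable matching instance with n students (Fin n) and
-- m schools (Fin m).  Scores are natural numbers; lower score = preferred.
record Instance (n m : ℕ) : Set where
  field
    quota       : Fin m → ℕ
    quota-pos   : ∀ x → 0 < quota x
    quota-sum   : sum (map quota (allFin m)) ≡ n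
    stScore     : Fin n → Fin m → ℕ
    scScore     : Fin m → Fin n → ℕ
    st-distinct : ∀ s x y → stScore s x ≡ stScore s y → x ≡ y
    sc-distinct : ∀ x s t → scScore x s ≡ scScore x t → s ≡ t

open Instance public

Symmetric : ∀ {n m} → Instance n m → Set
Symmetric I = ∀ s x → stScore I s x ≡ scScore I x s

load : ∀ {n m} → (Fin n → Fin m) → Fin m → ℕ
load {n} μ x = length (filter (λ s → μ s ≟ x) (allFin n))

IsMatching : ∀ {n m} → Instance n m → (Fin n → Fin m) → Set
IsMatching I μ = ∀ x → load μ x ≡ quota I x

BlockingPair : ∀ {n m} → Instance n m → (Fin n → Fin m) → Fin n → Fin m → Set
BlockingPair I μ s x =
  μ s ≢ x × stScore I s x < stScore I s (μ s)
  × ∃ λ t → μ t ≡ x × scScore I x s < scScore I x t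

IsStable : ∀ {n m} → Instance n m → (Fin n → Fin m) → Set
IsStable I μ = ∀ s x → ¬ BlockingPair I μ s x

-- State of the mutual closest pair algorithm: partial assignment of students
-- (nothing = unmatched) and remaining quota of each school.
record State (n m : ℕ) : Set where
  constructor ⟨_,_⟩
  field
    assign : Fin n → Maybe (Fin m)
    remain : Fin m → ℕ

open State public

initState : ∀ {n m} → Instance n m → State n m
initState I = ⟨ (λ _ → nothing) , quota I ⟩

update : ∀ {k} {A : Set} → (Fin k → A) → Fin k → A → Fin k → A
update f i a j with j ≟ i
... | yes _ = a
... | no  _ = f j

data Step {n m} (I : Instance n m) : State n m → State n m → Set where
  step : ∀ (a : Fin n → Maybe (Fin m)) (r : Fin m → ℕ) (s : Fin n) (x : Fin m) (k : ℕ)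
       → a s ≡ nothing
       → r x ≡ suc k
       → (∀ y → 0 < r y → stScore I s x ≤ stScore I s y)
       → (∀ t → a t ≡ nothing → scScore I x s ≤ scScore I x t)
       → Step I ⟨ a , r ⟩ ⟨ update a s (just x) , update r x k ⟩

Reachable : ∀ {n m} → Instance n m → State n m → Set
Reachable I st = Star (Step I) (initState I) st

-- every run of the algorithm from the initial state is finite
Terminates : ∀ {n m} → Instance n m → Set
Terminates I = Acc (flip (Step I)) (initState I)

-- The algorithm maintains five invariants: every school's remaining quota plus
-- its assigned students is its quota; the total remaining quota equals the
-- number of unmatched students; a school that some matched student prefers to
-- its own is already full; a school prefers each of its students to every
-- unmatched student; and no two matched students form a blocking pair.  The
-- last three hold because each step matches a mutual closest pair.  The
-- number of unmatched students drops at every step, so the algorithm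
-- terminates.  While a student is unmatched some school has a free seat; take
-- the unmatched student s whose closest open school x is nearest.  By symmetry
-- s is also the unmatched student closest to x, so the algorithm never gets
-- stuck.
-- When everybody is matched the invariants say that the assignment fills
-- every quota and has no blocking pair.
module Submission where

open import Defs
open import Data.Nat using (ℕ; zero; suc; pred; _+_; _<_; _≤_; _<?_; >-nonZero)
open import Data.Nat.Properties
  using ( +-0-commutativeMonoid; ≤-totalOrder; +-comm; +-assoc
        ; +-identityʳ; +-cancelʳ-≡; m≤m+n; n<1+n; ≤-trans; ≤-reflexive; <⇒≱
        ; <-irrefl; >⇒≢; ≮⇒≥; n≤0⇒n≡0; 0≢1+n; suc-pred; module ≤-Reasoning)
open import Data.Fin using (Fin; zero; suc; _≟_)
open import Data.Fin.Properties using (punchInᵢ≢i; any?)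
open import Data.Bool using (Bool; true; false; if_then_else_)
open import Data.Maybe using (Maybe; just; nothing; is-nothing)
open import Data.Maybe.Properties using (≡-dec)
open import Data.List using (List; length; filter; map; allFin; tabulate)
import Data.Nat.ListAction as List
open import Data.List.Properties using (map-tabulate)
open import Data.List.Relation.Unary.All using (lookup)
open import Data.List.Relation.Unary.All.Properties using (all-filter)
open import Data.List.Membership.Propositional.Properties using (∈-filter⁺; ∈-allFin)
open import Data.List.Extrema ≤-totalOrder using (argmin; argmin-all; f[argmin]≤f[xs])
open import Data.Vec.Functional using (Vector; removeAt)
open import Algebra.Properties.CommutativeMonoid.Sum +-0-commutativeMonoid
  using (sum; sum-remove; sum-cong-≗; sum-replicate-zero)
open import Data.Product using (Σ; ∃; _×_; _,_; proj₁; proj₂)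
open import Data.Sum using (_⊎_; inj₁; inj₂)
open import Data.Empty using (⊥)
open import Function using (_∘_)
open import Relation.Nullary using (yes; no; does; contradiction)
open import Relation.Unary using (Pred; Decidable)
open import Relation.Binary.PropositionalEquality
open import Relation.Binary.Definitions using (DecidableEquality)
open import Relation.Binary.Construct.Closure.ReflexiveTransitive using (Star; ε; _◅_)
import Relation.Binary.Construct.On as On
open import Induction.WellFounded using (module Subrelation)
open import Data.Nat.Induction using (<-wellFounded)

private
  variable
    k : ℕ
    A B : Set

update-same : (f : Fin k → A) (i : Fin k) (a : A) → update f i a i ≡ a
update-same f i a with i ≟ i
... | yes _   = refl
... | no i≢i  = contradiction refl i≢i

update-other : (f : Fin k → A) (i : Fin k) (a : A) {j : Fin k} → j ≢ i → update f i a j ≡ f j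
update-other f i a {j} j≢i with j ≟ i
... | yes j≡i = contradiction j≡i j≢i
... | no _    = refl

update-≡ : (f : Fin k → A) (i : Fin k) (a : A) {j : Fin k} {b : A}
         → update f i a j ≡ b → (j ≡ i × a ≡ b) ⊎ f j ≡ b
update-≡ f i a {j} eq with j ≟ i
... | yes j≡i = inj₁ (j≡i , eq)
... | no _    = inj₂ eq

update-∘ : (g : A → B) (f : Fin k → A) (i : Fin k) (a : A) → g ∘ update f i a ≗ update (g ∘ f) i (g a)
update-∘ g f i a j with j ≟ i
... | yes _ = refl
... | no _  = refl

sum-update : (f : Vector ℕ k) (i : Fin k) (v : ℕ) → sum (update f i v) + f i ≡ sum f + v
sum-update {suc k} f i v = begin
  sum (update f i v) + f i                          ≡⟨ cong (_+ f i) (sum-remove {i = i} (update f i v)) ⟩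
  (update f i v i + sum (removeAt (update f i v) i)) + f i
    ≡⟨ cong₂ (λ a b → (a + b) + f i) (update-same f i v)
             (sum-cong-≗ (λ j → update-other f i v (punchInᵢ≢i i j))) ⟩
  (v + rest) + f i                                  ≡⟨ +-comm (v + rest) (f i) ⟩
  f i + (v + rest)                                  ≡⟨ cong (f i +_) (+-comm v rest) ⟩
  f i + (rest + v)                                  ≡⟨ +-assoc (f i) rest v ⟨
  (f i + rest) + v                                  ≡⟨ cong (_+ v) (sum-remove {i = i} f) ⟨
  sum f + v                                         ∎
  where
  open ≡-Reasoning
  rest : ℕ
  rest = sum (removeAt f i)

≤-sum : (f : Vector ℕ k) (i : Fin k) → f i ≤ sum f
≤-sum {suc k} f i = ≤-trans (m≤m+n (f i) _) (≤-reflexive (sym (sum-remove {i = i} f)))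

sum-pos⇒∃-pos : (f : Vector ℕ k) → 0 < sum f → ∃ λ i → 0 < f i
sum-pos⇒∃-pos {k} f 0<sum with any? (λ i → 0 <? f i)
... | yes pos = pos
... | no ¬pos = contradiction (trans (sum-cong-≗ f≗0) (sum-replicate-zero k)) (>⇒≢ 0<sum)
  where
  f≗0 : ∀ i → f i ≡ 0
  f≗0 i = n≤0⇒n≡0 (≮⇒≥ (λ 0<fi → ¬pos (i , 0<fi)))

sum≡0⇒≡0 : (f : Vector ℕ k) → sum f ≡ 0 → ∀ i → f i ≡ 0
sum≡0⇒≡0 f sum≡0 i = n≤0⇒n≡0 (≤-trans (≤-sum f i) (≤-reflexive sum≡0))

sum-tabulate : (f : Vector ℕ k) → List.sum (tabulate f) ≡ sum f
sum-tabulate {zero}  f = refl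
sum-tabulate {suc k} f = cong (f zero +_) (sum-tabulate (f ∘ suc))

sum-allFin : (f : Vector ℕ k) → List.sum (map f (allFin k)) ≡ sum f
sum-allFin f = trans (cong List.sum (map-tabulate (λ i → i) f)) (sum-tabulate f)

∃-minimiser : ∀ {p} {P : Pred (Fin k) p} → Decidable P → (c : Fin k → ℕ)
            → ∃ P → ∃ λ i → P i × (∀ {j} → P j → c i ≤ c j)
∃-minimiser {k} P? c (i₀ , Pi₀) =
  argmin c i₀ candidates ,
  argmin-all c Pi₀ (all-filter P? (allFin k)) ,
  λ {j} Pj → lookup (f[argmin]≤f[xs] i₀ candidates) (∈-filter⁺ P? (∈-allFin j) Pj)
  where
  candidates : List (Fin k)
  candidates = filter P? (allFin k)

indicator : Bool → ℕ
indicator b = if b then 1 else 0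

count : (Fin k → Bool) → ℕ
count p = sum (indicator ∘ p)

count-true : ∀ k → count {k} (λ _ → true) ≡ k
count-true zero    = refl
count-true (suc k) = cong suc (count-true k)

count-update : (p : A → Bool) (f : Fin k → A) (i : Fin k) (a : A)
             → count (p ∘ update f i a) + indicator (p (f i)) ≡ count (p ∘ f) + indicator (p a)
count-update p f i a =
  trans (cong (_+ indicator (p (f i))) (sum-cong-≗ (update-∘ (indicator ∘ p) f i a)))
        (sum-update (indicator ∘ p ∘ f) i (indicator (p a)))

length-filter-tabulate : ∀ {p} {P : Pred A p} (P? : Decidable P) (f : Fin k → A)
                       → length (filter P? (tabulate f)) ≡ count (does ∘ P? ∘ f)
length-filter-tabulate {k = zero}  P? f = refl
length-filter-tabulate {k = suc k} P? f with does (P? (f zero))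
... | true  = cong suc (length-filter-tabulate P? (f ∘ suc))
... | false = length-filter-tabulate P? (f ∘ suc)

≢nothing⇒≡just : {v : Maybe A} → v ≢ nothing → ∃ λ z → v ≡ just z
≢nothing⇒≡just {v = just z}  _   = z , refl
≢nothing⇒≡just {v = nothing} v≢0 = contradiction refl v≢0

_≟ₘ_ : ∀ {m} → DecidableEquality (Maybe (Fin m))
_≟ₘ_ = ≡-dec _≟_

unmatched : ∀ {n m} → (Fin n → Maybe (Fin m)) → ℕ
unmatched a = count (is-nothing ∘ a)

assigned : ∀ {n m} → (Fin n → Maybe (Fin m)) → Fin m → ℕ
assigned a x = count (λ s → does (a s ≟ₘ just x))

record Invariant {n m} (I : Instance n m) (st : State n m) : Set where
  field
    quota-split       : ∀ x → remain st x + assigned (assign st) x ≡ quota I x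
    seats≡unmatched   : sum (remain st) ≡ unmatched (assign st)
    envied⇒full       : ∀ {s y x} → assign st s ≡ just y
                      → stScore I s x < stScore I s y → remain st x ≡ 0
    matched-preferred : ∀ {t x s} → assign st t ≡ just x → assign st s ≡ nothing
                      → scScore I x t ≤ scScore I x s
    no-blocking       : ∀ {s y t x} → assign st s ≡ just y → assign st t ≡ just x
                      → stScore I s x < stScore I s y → scScore I x s < scScore I x t → ⊥

open Invariant

invariant-init : ∀ {n m} (I : Instance n m) → Invariant I (initState I)
invariant-init {n} I .quota-split x = trans (cong (quota I x +_) (sum-replicate-zero n)) (+-identityʳ _)
invariant-init {n} I .seats≡unmatched =
  trans (sym (sum-allFin (quota I))) (trans (quota-sum I) (sym (count-true n)))
invariant-init I .envied⇒full ()
invariant-init I .matched-preferred ()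
invariant-init I .no-blocking ()

module _ {n m} (a : Fin n → Maybe (Fin m)) (s : Fin n) (x : Fin m) (a-s : a s ≡ nothing) where

  unmatched-step : unmatched (update a s (just x)) + 1 ≡ unmatched a
  unmatched-step = trans (cong (λ v → unmatched (update a s (just x)) + indicator (is-nothing v)) (sym a-s))
                         (trans (count-update is-nothing a s (just x)) (+-identityʳ _))

  assigned-step : ∀ y → assigned (update a s (just x)) y ≡ assigned a y + indicator (does (x ≟ y))
  assigned-step y = trans (sym (+-identityʳ _))
    (trans (cong (λ v → assigned (update a s (just x)) y + indicator (does (v ≟ₘ just y))) (sym a-s))
           (count-update (λ v → does (v ≟ₘ just y)) a s (just x)))

step-decreases-unmatched : ∀ {n m} {I : Instance n m} {st st′} → Step I st st′
                         → unmatched (assign st′) < unmatched (assign st)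
step-decreases-unmatched (step a r s x k a-s _ _ _) =
  subst (unmatched a′ <_) (trans (+-comm 1 (unmatched a′)) (unmatched-step a s x a-s)) (n<1+n (unmatched a′))
  where
  a′ : Fin _ → Maybe (Fin _)
  a′ = update a s (just x)

module StepPreservesInvariant
  {n m} {I : Instance n m} {a : Fin n → Maybe (Fin m)} {r : Fin m → ℕ} {s : Fin n} {x : Fin m} {k : ℕ}
  (a-s : a s ≡ nothing) (r-x : r x ≡ suc k)
  (closest-school : ∀ y → 0 < r y → stScore I s x ≤ stScore I s y)
  (closest-student : ∀ t → a t ≡ nothing → scScore I x s ≤ scScore I x t)
  (inv : Invariant I ⟨ a , r ⟩)
  where

  a′ : Fin n → Maybe (Fin m)
  a′ = update a s (just x)

  r′ : Fin m → ℕ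
  r′ = update r x k

  remain-step : ∀ y → r′ y + indicator (does (x ≟ y)) ≡ r y
  remain-step y with x ≟ y
  ... | yes refl = trans (cong (_+ 1) (update-same r x k)) (trans (+-comm k 1) (sym r-x))
  ... | no x≢y   = trans (+-identityʳ _) (update-other r x k (x≢y ∘ sym))

  full-stays-full : ∀ {y} → r y ≡ 0 → r′ y ≡ 0
  full-stays-full {y} r-y = trans (update-other r x k y≢x) r-y
    where
    y≢x : y ≢ x
    y≢x refl = 0≢1+n (trans (sym r-y) r-x)

  still-unmatched : ∀ {t} → a′ t ≡ nothing → a t ≡ nothing
  still-unmatched {t} a′-t with update-≡ a s (just x) {t} a′-t
  ... | inj₁ (_ , ())
  ... | inj₂ a-t = a-t

  quota-split′ : ∀ y → r′ y + assigned a′ y ≡ quota I y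
  quota-split′ y = begin
    r′ y + assigned a′ y                     ≡⟨ cong (r′ y +_) (assigned-step a s x a-s y) ⟩
    r′ y + (assigned a y + new)              ≡⟨ cong (r′ y +_) (+-comm (assigned a y) new) ⟩
    r′ y + (new + assigned a y)              ≡⟨ +-assoc (r′ y) new (assigned a y) ⟨
    (r′ y + new) + assigned a y              ≡⟨ cong (_+ assigned a y) (remain-step y) ⟩
    r y + assigned a y                       ≡⟨ quota-split inv y ⟩
    quota I y                                ∎
    where
    open ≡-Reasoning
    new : ℕ
    new = indicator (does (x ≟ y))

  seats-step : sum r′ + 1 ≡ sum r
  seats-step = +-cancelʳ-≡ k (sum r′ + 1) (sum r)
    (trans (+-assoc (sum r′) 1 k) (trans (cong (sum r′ +_) (sym r-x)) (sum-update r x k)))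

  seats≡unmatched′ : sum r′ ≡ unmatched a′
  seats≡unmatched′ = +-cancelʳ-≡ 1 (sum r′) (unmatched a′) (begin
    sum r′ + 1       ≡⟨ seats-step ⟩
    sum r            ≡⟨ seats≡unmatched inv ⟩
    unmatched a      ≡⟨ unmatched-step a s x a-s ⟨
    unmatched a′ + 1 ∎)
    where open ≡-Reasoning

  envied⇒full′ : ∀ {t y z} → a′ t ≡ just y → stScore I t z < stScore I t y → r′ z ≡ 0
  envied⇒full′ {t} a′-t lt with update-≡ a s (just x) {t} a′-t
  ... | inj₁ (refl , refl) = full-stays-full (n≤0⇒n≡0 (≮⇒≥ (λ 0<r-z → <⇒≱ lt (closest-school _ 0<r-z))))
  ... | inj₂ a-t           = full-stays-full (envied⇒full inv a-t lt)

  matched-preferred′ : ∀ {t y u} → a′ t ≡ just y → a′ u ≡ nothing → scScore I y t ≤ scScore I y u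
  matched-preferred′ {t} a′-t a′-u with update-≡ a s (just x) {t} a′-t
  ... | inj₁ (refl , refl) = closest-student _ (still-unmatched a′-u)
  ... | inj₂ a-t           = matched-preferred inv a-t (still-unmatched a′-u)

  no-blocking′ : ∀ {t y u z} → a′ t ≡ just y → a′ u ≡ just z
               → stScore I t z < stScore I t y → scScore I z t < scScore I z u → ⊥
  no-blocking′ {t} {u = u} a′-t a′-u lt₁ lt₂ with update-≡ a s (just x) {t} a′-t | update-≡ a s (just x) {u} a′-u
  ... | inj₁ (refl , refl) | inj₁ (refl , refl) = <-irrefl refl lt₂
  ... | inj₁ (refl , refl) | inj₂ a-u           = <⇒≱ lt₂ (matched-preferred inv a-u a-s)
  ... | inj₂ a-t           | inj₁ (refl , refl) = 0≢1+n (trans (sym (envied⇒full inv a-t lt₁)) r-x)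
  ... | inj₂ a-t           | inj₂ a-u           = no-blocking inv a-t a-u lt₁ lt₂

  invariant′ : Invariant I ⟨ a′ , r′ ⟩
  invariant′ = record
    { quota-split       = quota-split′
    ; seats≡unmatched   = seats≡unmatched′
    ; envied⇒full       = envied⇒full′
    ; matched-preferred = matched-preferred′
    ; no-blocking       = no-blocking′
    }

module _ {n m} (I : Instance n m) where

  step-preserves : ∀ {st st′} → Step I st st′ → Invariant I st → Invariant I st′
  step-preserves (step a r s x k a-s r-x closest-school closest-student) =
    StepPreservesInvariant.invariant′ a-s r-x closest-school closest-student

  invariant-star : ∀ {st st′} → Star (Step I) st st′ → Invariant I st → Invariant I st′
  invariant-star ε            inv = inv
  invariant-star (stp ◅ stps) inv = invariant-star stps (step-preserves stp inv)

  terminates : Terminates I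
  terminates = Subrelation.accessible step-decreases-unmatched
                 (On.accessible (unmatched ∘ assign) (<-wellFounded _))

  mutual-closest-pair : Symmetric I → ∀ {a r} → Invariant I ⟨ a , r ⟩
                      → ∀ {s₀} → a s₀ ≡ nothing → ∃ λ st′ → Step I ⟨ a , r ⟩ st′
  mutual-closest-pair symmetric {a} {r} inv {s₀} a-s₀ =
    pair (∃-minimiser (λ t → a t ≟ₘ nothing) distance (s₀ , a-s₀))
    where
    open-school : ∃ λ y → 0 < r y
    open-school = sum-pos⇒∃-pos r (subst (0 <_) (sym (seats≡unmatched inv))
      (subst (_≤ unmatched a) (cong (indicator ∘ is-nothing) a-s₀) (≤-sum (indicator ∘ is-nothing ∘ a) s₀)))

    closest-open : ∀ t → ∃ λ y → 0 < r y × (∀ {z} → 0 < r z → stScore I t y ≤ stScore I t z)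
    closest-open t = ∃-minimiser (λ y → 0 <? r y) (stScore I t) open-school

    distance : Fin n → ℕ
    distance t = stScore I t (proj₁ (closest-open t))

    pair : (∃ λ s → a s ≡ nothing × (∀ {t} → a t ≡ nothing → distance s ≤ distance t))
         → ∃ λ st′ → Step I ⟨ a , r ⟩ st′
    pair (s , a-s , s-nearest) =
      _ , step a r s x (pred (r x)) a-s (sym (suc-pred (r x) {{>-nonZero 0<r-x}})) (λ _ → x-closest) closest-student
      where
      x : Fin m
      x = proj₁ (closest-open s)
      0<r-x : 0 < r x
      0<r-x = proj₁ (proj₂ (closest-open s))
      x-closest : ∀ {z} → 0 < r z → stScore I s x ≤ stScore I s z
      x-closest = proj₂ (proj₂ (closest-open s))
      closest-student : ∀ t → a t ≡ nothing → scScore I x s ≤ scScore I x t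
      closest-student t a-t = begin
        scScore I x s  ≡⟨ symmetric s x ⟨
        stScore I s x  ≤⟨ s-nearest a-t ⟩
        distance t     ≤⟨ proj₂ (proj₂ (closest-open t)) 0<r-x ⟩
        stScore I t x  ≡⟨ symmetric t x ⟩
        scScore I x t  ∎
        where open ≤-Reasoning

  complete-matching : ∀ {st} → Invariant I st → (∀ s → assign st s ≢ nothing)
                    → Σ (Fin n → Fin m) λ μ
                        → (∀ s → assign st s ≡ just (μ s)) × IsMatching I μ × IsStable I μ
  complete-matching {st} inv all-matched = μ , μ-spec , matching , stable
    where
    μ : Fin n → Fin m
    μ s = proj₁ (≢nothing⇒≡just (all-matched s))
    μ-spec : ∀ s → assign st s ≡ just (μ s)
    μ-spec s = proj₂ (≢nothing⇒≡just (all-matched s))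

    no-seats-left : ∀ x → remain st x ≡ 0
    no-seats-left = sum≡0⇒≡0 (remain st) (begin
      sum (remain st)           ≡⟨ seats≡unmatched inv ⟩
      unmatched (assign st)     ≡⟨ sum-cong-≗ (cong (indicator ∘ is-nothing) ∘ μ-spec) ⟩
      sum {n} (λ _ → 0)         ≡⟨ sum-replicate-zero n ⟩
      0                         ∎)
      where open ≡-Reasoning

    matching : IsMatching I μ
    matching x = begin
      load μ x                       ≡⟨ length-filter-tabulate (λ s → μ s ≟ x) (λ s → s) ⟩
      -- `does (just y ≟ₘ just x)` computes to `does (y ≟ x)`
      count (λ s → does (μ s ≟ x))   ≡⟨ sum-cong-≗ (cong (λ v → indicator (does (v ≟ₘ just x))) ∘ μ-spec) ⟨
      assigned (assign st) x         ≡⟨ cong (_+ assigned (assign st) x) (no-seats-left x) ⟨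
      remain st x + assigned (assign st) x ≡⟨ quota-split inv x ⟩
      quota I x                      ∎
      where open ≡-Reasoning

    stable : IsStable I μ
    stable s x (_ , prefers-x , t , μ-t , prefers-s) =
      no-blocking inv (μ-spec s) (trans (μ-spec t) (cong just μ-t)) prefers-x prefers-s

theorem2p4 : ∀ {n m} (I : Instance n m) → Symmetric I
    → Terminates I
    × (∀ st → Reachable I st
    → (∀ s → assign st s ≡ nothing → ∃ λ st' → Step I st st')
    × ((∀ s → assign st s ≢ nothing)
    → Σ (Fin n → Fin m) λ μ
    → (∀ s → assign st s ≡ just (μ s))
    × IsMatching I μ × IsStable I μ))
theorem2p4 I symmetric = terminates I , λ st reachable →
  let inv = invariant-star I reachable (invariant-init I)
  in (λ s unmatched-s → mutual-closest-pair I symmetric inv unmatched-s) , complete-matching I inv
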